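{- Every graph in the class $\mathcal{G}_\text{rec}$ is ribbon-cutting.
   Context: For a graph $G$, two edges are related if they are opposite edges of a 4-cycle subgraph of $G$; a ribbon is an equivalence class of the reflexive–transitive closure of this relation. A set of edges $r$ is an edge cut of a connected graph $G$ if $(V_G,E_G\setminus r)$ is disconnected. A ribbon-cutting graph is a connected graph in which every ribbon is an edge cut. Two vertices $x,y$ are separated by a ribbon $r$ if they lie in different connected components of $(V_G,E_G\setminus r)$. The class $\mathcal{G}_\text{rec}$ is defined recursively: the 4-cycle graph is in $\mathcal{G}_\text{rec}$, and $\mathcal{G}_\text{rec}$ is closed under two operations. Add4-cycle: if $G\in\mathcal{G}_\text{rec}$ and $uv\in E_G$, then $(V_G\cup\{w_1,w_2\},E_G\cup\{uw_1,w_1w_2,w_2v\})$ with new vertices $w_1,w_2\notin V_G$ is in $\mathcal{G}_\text{rec}$. Close4-cycle: if $G\in\mathcal{G}_\text{rec}$ with $uv,vw\in E_G$ such that for every vertex $x\in V_G\setminus\{u,v,w\}$ there is a ribbon of $G$ containing neither $uv$ nor $vw$ that separates $v$ and $x$, then $(V_G\cup\{w'\},E_G\cup\{uw',w'w\})$ with a new vertex $w'\notin V_G$ is in $\mathcal{G}_\text{rec}$. -}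

module Defs where

open import Data.Nat using (ℕ; zero; suc)
open import Data.Fin using (Fin; zero; suc)
open import Data.Product using (Σ; _×_; _,_; ∃)
open import Data.Sum using (_⊎_; inj₁; inj₂)
open import Data.Empty using (⊥)
open import Data.Unit using (⊤; tt)
open import Relation.Nullary using (¬_)
open import Relation.Binary.PropositionalEquality using (_≡_; _≢_; refl)
open import Relation.Binary.Construct.Closure.ReflexiveTransitive using (Star)

record Graph : Set₁ where
  field
    n      : ℕ
    E      : Fin n → Fin n → Set
    sym    : ∀ {x y} → E x y → E y x
    irrefl : ∀ {x} → E x x → ⊥
open Graph public

Pair : Graph → Set
Pair G = Fin (n G) × Fin (n G)

-- One step of the relation generating ribbons, on oriented edges (pairs):
--  * flip identifies the two orientations of the same undirected edge;
--  * opp relates ab and cd when a-b-c-d-a is a 4-cycle subgraph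
--    (four distinct vertices), i.e. ab and cd are opposite edges of it.
data Step (G : Graph) : Pair G → Pair G → Set where
  flip : ∀ {a b} → Step G (a , b) (b , a)
  opp  : ∀ {a b c d} →
         a ≢ b → a ≢ c → a ≢ d → b ≢ c → b ≢ d → c ≢ d →
         E G a b → E G b c → E G c d → E G d a →
         Step G (a , b) (c , d)

SameRibbon : (G : Graph) → Pair G → Pair G → Set
SameRibbon G = Star (Step G)

Connected : Graph → Set
Connected G = ∀ x y → Star (E G) x y

AdjMinus : (G : Graph) → Pair G → Fin (n G) → Fin (n G) → Set
AdjMinus G e x y = E G x y × ¬ SameRibbon G e (x , y)

Separates : (G : Graph) → Pair G → Fin (n G) → Fin (n G) → Set
Separates G e x y = ¬ Star (AdjMinus G e) x y

-- The ribbon of e is an edge cut (G connected is required separately).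
IsEdgeCut : (G : Graph) → Pair G → Set
IsEdgeCut G e = Σ (Fin (n G)) λ x → Σ (Fin (n G)) λ y → Separates G e x y

-- Every ribbon is the ribbon of some edge (a , b) with E a b.
RibbonCutting : Graph → Set
RibbonCutting G = Connected G × (∀ a b → E G a b → IsEdgeCut G (a , b))

C4E : Fin 4 → Fin 4 → Set
C4E zero (suc zero) = ⊤
C4E (suc zero) zero = ⊤
C4E (suc zero) (suc (suc zero)) = ⊤
C4E (suc (suc zero)) (suc zero) = ⊤
C4E (suc (suc zero)) (suc (suc (suc zero))) = ⊤
C4E (suc (suc (suc zero))) (suc (suc zero)) = ⊤
C4E (suc (suc (suc zero))) zero = ⊤
C4E zero (suc (suc (suc zero))) = ⊤
C4E _ _ = ⊥

C4sym : ∀ {x y} → C4E x y → C4E y x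
C4sym {zero} {suc zero} p = tt
C4sym {suc zero} {zero} p = tt
C4sym {suc zero} {suc (suc zero)} p = tt
C4sym {suc (suc zero)} {suc zero} p = tt
C4sym {suc (suc zero)} {suc (suc (suc zero))} p = tt
C4sym {suc (suc (suc zero))} {suc (suc zero)} p = tt
C4sym {suc (suc (suc zero))} {zero} p = tt
C4sym {zero} {suc (suc (suc zero))} p = tt

C4irr : ∀ {x} → C4E x x → ⊥
C4irr {zero} ()
C4irr {suc zero} ()
C4irr {suc (suc zero)} ()
C4irr {suc (suc (suc zero))} ()

C4 : Graph
C4 = record { n = 4 ; E = C4E ; sym = C4sym ; irrefl = C4irr }

-- Add4-cycle: new vertices w1 = zero, w2 = suc zero; old vertex x is
-- suc (suc x).  New edges u w1, w1 w2, w2 v.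

module _ (G : Graph) (u v : Fin (n G)) where
  add4E : Fin (suc (suc (n G))) → Fin (suc (suc (n G))) → Set
  add4E (suc (suc x)) (suc (suc y)) = E G x y
  add4E zero (suc zero) = ⊤
  add4E (suc zero) zero = ⊤
  add4E zero (suc (suc x)) = x ≡ u
  add4E (suc (suc x)) zero = x ≡ u
  add4E (suc zero) (suc (suc x)) = x ≡ v
  add4E (suc (suc x)) (suc zero) = x ≡ v
  add4E zero zero = ⊥
  add4E (suc zero) (suc zero) = ⊥

  add4sym : ∀ {x y} → add4E x y → add4E y x
  add4sym {suc (suc x)} {suc (suc y)} p = sym G p
  add4sym {zero} {suc zero} p = tt
  add4sym {suc zero} {zero} p = tt
  add4sym {zero} {suc (suc x)} p = p
  add4sym {suc (suc x)} {zero} p = p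
  add4sym {suc zero} {suc (suc x)} p = p
  add4sym {suc (suc x)} {suc zero} p = p

  add4irr : ∀ {x} → add4E x x → ⊥
  add4irr {suc (suc x)} p = irrefl G p

  Add4 : Graph
  Add4 = record { n = suc (suc (n G)) ; E = add4E ; sym = λ {x} {y} → add4sym {x} {y} ; irrefl = λ {x} → add4irr {x} }

-- Close4-cycle: new vertex w' = zero; old vertex x is suc x.
-- New edges u w', w' w.

module _ (G : Graph) (u w : Fin (n G)) where
  close4E : Fin (suc (n G)) → Fin (suc (n G)) → Set
  close4E (suc x) (suc y) = E G x y
  close4E zero (suc x) = x ≡ u ⊎ x ≡ w
  close4E (suc x) zero = x ≡ u ⊎ x ≡ w
  close4E zero zero = ⊥

  close4sym : ∀ {x y} → close4E x y → close4E y x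
  close4sym {suc x} {suc y} p = sym G p
  close4sym {zero} {suc x} p = p
  close4sym {suc x} {zero} p = p

  close4irr : ∀ {x} → close4E x x → ⊥
  close4irr {suc x} p = irrefl G p

  Close4 : Graph
  Close4 = record { n = suc (n G) ; E = close4E ; sym = λ {x} {y} → close4sym {x} {y} ; irrefl = λ {x} → close4irr {x} }

Close4Cond : (G : Graph) (u v w : Fin (n G)) → Set
Close4Cond G u v w =
  ∀ x → x ≢ u → x ≢ v → x ≢ w →
  Σ (Fin (n G)) λ a → Σ (Fin (n G)) λ b → E G a b ×
    (¬ SameRibbon G (a , b) (u , v)) ×
    (¬ SameRibbon G (a , b) (v , w)) ×
    Separates G (a , b) v x

-- The class G_rec (up to relabelling of vertices).
data Rec : Graph → Set₁ where
  base   : Rec C4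
  add4   : ∀ {G} → Rec G → (u v : Fin (n G)) → E G u v → Rec (Add4 G u v)
  close4 : ∀ {G} → Rec G → (u v w : Fin (n G)) → E G u v → E G v w →
           Close4Cond G u v w → Rec (Close4 G u w)

module Submission where

-- Two general principles do all the work.
--  * Colouring criterion: if a 2-colouring of the vertices has all its
--    bichromatic edges inside one ribbon, then that ribbon separates any two
--    vertices of different colours; hence every bichromatic edge spans a cut.
--  * Separation transfer: let G embed into G'.  If from every vertex of G'
--    that reaches an old vertex ι y in G' minus the ribbon r' one can also
--    reach y in G minus the ribbon r (a backward-closed "reachability
--    certificate"), then r' separates ι x and ι y whenever r separates x, y.
-- For Add4-cycle and Close4-cycle, every edge of the new graph either lies in
-- the ribbon of an old edge (via the new 4-cycle), so that the old cut
-- transfers, or is bichromatic for the colouring "new vertices vs old ones"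
-- (the pendant path, or a pendant vertex when u = w).  Connectivity is kept
-- because each new vertex is adjacent to an old one.  The base case C4 is
-- settled by two colourings.

open import Defs
open import Data.Fin using (Fin; zero; suc; _≟_)
open import Data.Fin.Properties using (suc-injective)
open import Data.Bool using (Bool; true; false) renaming (_≟_ to _≟ᵇ_)
open import Data.Product using (_×_; _,_)
open import Data.Sum using (_⊎_; inj₁; inj₂)
open import Data.Empty using (⊥-elim)
open import Data.Unit using (tt)
open import Function using (id; _∘_)
open import Relation.Nullary using (¬_; yes; no)
open import Relation.Binary.PropositionalEquality
  using (_≡_; _≢_; refl; subst) renaming (sym to ≡-sym; trans to ≡-trans)
open import Relation.Binary.Construct.Closure.ReflexiveTransitive

step-sym : ∀ {G p q} → Step G p q → Step G q p
step-sym flip = flip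
step-sym (opp ab ac ad bc bd cd e₁ e₂ e₃ e₄) =
  opp cd (ac ∘ ≡-sym) (bc ∘ ≡-sym) (ad ∘ ≡-sym) (bd ∘ ≡-sym) ab e₃ e₄ e₁ e₂

ribbon-sym : ∀ {G p q} → SameRibbon G p q → SameRibbon G q p
ribbon-sym = reverse step-sym

ribbon-swapˡ : ∀ {G a b q} → SameRibbon G (a , b) q → SameRibbon G (b , a) q
ribbon-swapˡ s = flip ◅ s

ribbon-swapʳ : ∀ {G p a b} → SameRibbon G p (a , b) → SameRibbon G p (b , a)
ribbon-swapʳ s = s ◅◅ flip ◅ ε

avoid : ∀ {G r p q} → SameRibbon G p q → ¬ SameRibbon G r q → ¬ SameRibbon G r p
avoid s n t = n (t ◅◅ s)

separates-resp : ∀ {G e₁ e₂ x y} →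
  SameRibbon G e₁ e₂ → Separates G e₂ x y → Separates G e₁ x y
separates-resp s sep W = sep (gmap id (λ { (exy , n) → exy , λ t → n (s ◅◅ t) }) W)

module _ {G : Graph} (f : Fin (n G) → Bool) {e : Pair G}
         (cross : ∀ p q → E G p q → f p ≢ f q → SameRibbon G e (p , q)) where

  -- Removing a ribbon containing all bichromatic edges leaves only
  -- monochromatic edges, so the colour is constant along walks.
  colour-invariant : ∀ {x y} → Star (AdjMinus G e) x y → f x ≡ f y
  colour-invariant ε = refl
  colour-invariant ((exz , n) ◅ W) with f _ ≟ᵇ f _
  ... | yes same = ≡-trans same (colour-invariant W)
  ... | no diff  = ⊥-elim (n (cross _ _ exz diff))

  bichromatic-cut : ∀ p q → E G p q → f p ≢ f q → IsEdgeCut G (p , q)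
  bichromatic-cut p q epq diff =
    p , q , separates-resp (ribbon-sym (cross p q epq diff)) (diff ∘ colour-invariant)

module Embedding (G G' : Graph) (ι : Fin (n G) → Fin (n G'))
  (ι-injective : ∀ {a b} → ι a ≡ ι b → a ≡ b)
  (ι-edge : ∀ {a b} → E G a b → E G' (ι a) (ι b)) where

  lift : Pair G → Pair G'
  lift (a , b) = ι a , ι b

  ι-≢ : ∀ {a b} → a ≢ b → ι a ≢ ι b
  ι-≢ a≢b = a≢b ∘ ι-injective

  lift-step : ∀ {p q} → Step G p q → Step G' (lift p) (lift q)
  lift-step flip = flip
  lift-step (opp ab ac ad bc bd cd e₁ e₂ e₃ e₄) =
    opp (ι-≢ ab) (ι-≢ ac) (ι-≢ ad) (ι-≢ bc) (ι-≢ bd) (ι-≢ cd)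
        (ι-edge e₁) (ι-edge e₂) (ι-edge e₃) (ι-edge e₄)

  lift-ribbon : ∀ {p q} → SameRibbon G p q → SameRibbon G' (lift p) (lift q)
  lift-ribbon = gmap lift lift-step

  avoid-old : ∀ {r' e p} →
    SameRibbon G' r' (lift e) → ¬ SameRibbon G' r' (lift p) → ¬ SameRibbon G e p
  avoid-old s n t = n (s ◅◅ lift-ribbon t)

  connected-extension : Connected G → (ρ : Fin (n G') → Fin (n G)) →
    (∀ x → Star (E G') x (ι (ρ x))) → Connected G'
  connected-extension conn ρ to-old x y =
    to-old x ◅◅ gmap ι ι-edge (conn (ρ x) (ρ y)) ◅◅ reverse (sym G') (to-old y)

  separation-transfer : ∀ {e e'} (Reach : Fin (n G') → Fin (n G) → Set) →
    (∀ p q {y} → AdjMinus G' e' p q → Reach q y → Reach p y) →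
    (∀ y → Reach (ι y) y) →
    (∀ {x y} → Reach (ι x) y → Star (AdjMinus G e) x y) →
    ∀ {x y} → Separates G e x y → Separates G' e' (ι x) (ι y)
  separation-transfer {e' = e'} Reach back here exit {y = y} sep W =
    sep (exit (reach W (here y)))
    where
    reach : ∀ {p q} → Star (AdjMinus G' e') p q → Reach q y → Reach p y
    reach ε       = id
    reach (s ◅ W) = back _ _ s ∘ reach W

module Add4Cutting (G : Graph) (u v : Fin (n G)) (uv : E G u v) where
  G' : Graph
  G' = Add4 G u v

  old : Fin (n G) → Fin (n G')
  old x = suc (suc x)

  open Embedding G G' old (suc-injective ∘ suc-injective) id

  u≢v : u ≢ v
  u≢v refl = irrefl G uv

  -- uv and w₁w₂ are opposite edges of the new 4-cycle u v w₂ w₁.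
  uv~w₁w₂ : SameRibbon G' (old u , old v) (zero , suc zero)
  uv~w₁w₂ = ribbon-swapʳ (opp (ι-≢ u≢v) (λ ()) (λ ()) (λ ()) (λ ()) (λ ()) uv refl tt refl ◅ ε)

  -- Retraction collapsing the new path onto the edge uv.
  retract : Fin (n G') → Fin (n G)
  retract zero = u
  retract (suc zero) = v
  retract (suc (suc x)) = x

  retract-step : ∀ {e r'} → SameRibbon G' r' (lift e) →
    ∀ p q → AdjMinus G' r' p q → Star (AdjMinus G e) (retract p) (retract q)
  retract-step s (suc (suc a)) (suc (suc b)) (eab , n) = (eab , avoid-old s n) ◅ ε
  retract-step s zero (suc zero) (_ , n) = (uv , avoid-old s (avoid uv~w₁w₂ n)) ◅ ε
  retract-step s (suc zero) zero (_ , n) =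
    (sym G uv , avoid-old s (avoid (ribbon-swapˡ (ribbon-swapʳ uv~w₁w₂)) n)) ◅ ε
  retract-step s zero (suc (suc x)) (refl , _) = ε
  retract-step s (suc (suc x)) zero (refl , _) = ε
  retract-step s (suc zero) (suc (suc x)) (refl , _) = ε
  retract-step s (suc (suc x)) (suc zero) (refl , _) = ε

  inherited-cut : ∀ {e r'} → SameRibbon G' r' (lift e) → IsEdgeCut G e → IsEdgeCut G' r'
  inherited-cut {e} s (x , y , sep) =
    old x , old y ,
    separation-transfer (λ p y → Star (AdjMinus G e) (retract p) y)
      (λ p q st P → retract-step s p q st ◅◅ P) (λ _ → ε) id sep

  -- Colour the new vertices true: the bichromatic edges uw₁, w₂v are
  -- opposite in the 4-cycle u v w₂ w₁, so they form one ribbon.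
  new : Fin (n G') → Bool
  new zero = true
  new (suc zero) = true
  new (suc (suc _)) = false

  uw₁~vw₂ : Step G' (zero , old u) (old v , suc zero)
  uw₁~vw₂ = opp (λ ()) (λ ()) (λ ()) (ι-≢ u≢v) (λ ()) (λ ()) refl uv refl tt

  new-cross : ∀ p q → E G' p q → new p ≢ new q → SameRibbon G' (zero , old u) (p , q)
  new-cross zero (suc (suc x)) refl _ = ε
  new-cross (suc (suc x)) zero refl _ = flip ◅ ε
  new-cross (suc zero) (suc (suc x)) refl _ = ribbon-swapʳ (uw₁~vw₂ ◅ ε)
  new-cross (suc (suc x)) (suc zero) refl _ = uw₁~vw₂ ◅ ε
  new-cross zero (suc zero) _ diff = ⊥-elim (diff refl)
  new-cross (suc zero) zero _ diff = ⊥-elim (diff refl)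
  new-cross (suc (suc x)) (suc (suc y)) _ diff = ⊥-elim (diff refl)

  pendant-cut : ∀ p q → E G' p q → new p ≢ new q → IsEdgeCut G' (p , q)
  pendant-cut = bichromatic-cut new new-cross

  to-old : ∀ x → Star (E G') x (old (retract x))
  to-old zero = refl ◅ ε
  to-old (suc zero) = refl ◅ ε
  to-old (suc (suc x)) = ε

  ribbon-cutting : RibbonCutting G → RibbonCutting G'
  ribbon-cutting (conn , cut) = connected-extension conn retract to-old , cut'
    where
    cut' : ∀ a b → E G' a b → IsEdgeCut G' (a , b)
    cut' (suc (suc a)) (suc (suc b)) eab = inherited-cut ε (cut a b eab)
    cut' zero (suc zero) _ = inherited-cut (ribbon-sym uv~w₁w₂) (cut u v uv)
    cut' (suc zero) zero _ = inherited-cut (ribbon-swapˡ (ribbon-sym uv~w₁w₂)) (cut u v uv)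
    cut' zero (suc (suc x)) e = pendant-cut _ _ e (λ ())
    cut' (suc (suc x)) zero e = pendant-cut _ _ e (λ ())
    cut' (suc zero) (suc (suc x)) e = pendant-cut _ _ e (λ ())
    cut' (suc (suc x)) (suc zero) e = pendant-cut _ _ e (λ ())

module Close4Cutting (G : Graph) (u v w : Fin (n G)) (uv : E G u v) (vw : E G v w) where
  G' : Graph
  G' = Close4 G u w

  open Embedding G G' suc suc-injective id

  u≢v : u ≢ v
  u≢v refl = irrefl G uv

  v≢w : v ≢ w
  v≢w refl = irrefl G vw

  ≢-sym : ∀ {a b : Fin (n G)} → a ≢ b → b ≢ a
  ≢-sym a≢b = a≢b ∘ ≡-sym

  -- For u ≢ w the new 4-cycle u v w w' has opposite pairs uv, ww' and vw, w'u.
  module Square (u≢w : u ≢ w) where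
    uv~ww' : SameRibbon G' (lift (u , v)) (suc w , zero)
    uv~ww' = opp (ι-≢ u≢v) (ι-≢ u≢w) (λ ()) (ι-≢ v≢w) (λ ()) (λ ()) uv vw (inj₂ refl) (inj₁ refl) ◅ ε

    vw~w'u : SameRibbon G' (lift (v , w)) (zero , suc u)
    vw~w'u = opp (ι-≢ v≢w) (λ ()) (ι-≢ (≢-sym u≢v)) (λ ()) (ι-≢ (≢-sym u≢w)) (λ ())
                 vw (inj₂ refl) (inj₁ refl) uv ◅ ε

  -- A new-graph vertex p "reaches" y
  -- if p is old and reaches y in G minus the ribbon of e, or p = w' and one
  -- of its edges w'u, w'w outside r' leads to an old vertex reaching y.
  module Certificate {e : Pair G} {r' : Pair G'} (s : SameRibbon G' r' (lift e)) where
    Reach : Fin (n G') → Fin (n G) → Set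
    Reach (suc x) y = Star (AdjMinus G e) x y
    Reach zero y = (Star (AdjMinus G e) u y × ¬ SameRibbon G' r' (zero , suc u))
                 ⊎ (Star (AdjMinus G e) w y × ¬ SameRibbon G' r' (zero , suc w))

    -- Entering w' from u but leaving towards w: detour u v w, which avoids the
    -- ribbon because uv ~ ww' and vw ~ w'u are outside r'.
    detour-u→w : ∀ {y} → ¬ SameRibbon G' r' (suc u , zero) → ¬ SameRibbon G' r' (zero , suc w) →
      Star (AdjMinus G e) w y → Star (AdjMinus G e) u y
    detour-u→w {y} n₁ n₂ P with u ≟ w
    ... | yes u≡w = subst (λ z → Star (AdjMinus G e) z y) (≡-sym u≡w) P
    ... | no u≢w = (uv , avoid-old s (avoid (ribbon-swapʳ uv~ww') n₂))
                 ◅ (vw , avoid-old s (avoid (ribbon-swapʳ vw~w'u) n₁)) ◅ P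
      where open Square u≢w

    detour-w→u : ∀ {y} → ¬ SameRibbon G' r' (suc w , zero) → ¬ SameRibbon G' r' (zero , suc u) →
      Star (AdjMinus G e) u y → Star (AdjMinus G e) w y
    detour-w→u {y} n₁ n₂ P with u ≟ w
    ... | yes u≡w = subst (λ z → Star (AdjMinus G e) z y) u≡w P
    ... | no u≢w = (sym G vw , avoid-old s (avoid (ribbon-swapˡ vw~w'u) n₂))
                 ◅ (sym G uv , avoid-old s (avoid (ribbon-swapˡ uv~ww') n₁)) ◅ P
      where open Square u≢w

    back : ∀ p q {y} → AdjMinus G' r' p q → Reach q y → Reach p y
    back (suc a) (suc b) (eab , n) P = (eab , avoid-old s n) ◅ P
    back (suc a) zero (inj₁ refl , n) (inj₁ (P , _)) = P
    back (suc a) zero (inj₁ refl , n) (inj₂ (P , n₂)) = detour-u→w n n₂ P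
    back (suc a) zero (inj₂ refl , n) (inj₂ (P , _)) = P
    back (suc a) zero (inj₂ refl , n) (inj₁ (P , n₂)) = detour-w→u n n₂ P
    back zero (suc b) (inj₁ refl , n) P = inj₁ (P , n)
    back zero (suc b) (inj₂ refl , n) P = inj₂ (P , n)

  inherited-cut : ∀ {e r'} → SameRibbon G' r' (lift e) → IsEdgeCut G e → IsEdgeCut G' r'
  inherited-cut s (x , y , sep) =
    suc x , suc y , separation-transfer Reach back (λ _ → ε) id sep
    where open Certificate s

  -- For u = w, w' is a pendant vertex: colour it apart from the old vertices.
  new : Fin (n G') → Bool
  new zero = true
  new (suc _) = false

  pendant-cut : u ≡ w → ∀ x → E G' zero (suc x) → IsEdgeCut G' (zero , suc x)
  pendant-cut u≡w x ex = bichromatic-cut new cross zero (suc x) ex (λ ())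
    where
    at-u : ∀ {z} → z ≡ u ⊎ z ≡ w → z ≡ u
    at-u (inj₁ z≡u) = z≡u
    at-u (inj₂ z≡w) = ≡-trans z≡w (≡-sym u≡w)

    to-pendant : ∀ {z} → z ≡ u ⊎ z ≡ w → SameRibbon G' (zero , suc u) (zero , suc z)
    to-pendant ez = subst (λ t → SameRibbon G' (zero , suc u) (zero , suc t)) (≡-sym (at-u ez)) ε

    cross : ∀ p q → E G' p q → new p ≢ new q → SameRibbon G' (zero , suc u) (p , q)
    cross zero (suc z) ez _ = to-pendant ez
    cross (suc z) zero ez _ = ribbon-swapʳ (to-pendant ez)
    cross (suc a) (suc b) _ diff = ⊥-elim (diff refl)

  new-edge-cut : RibbonCutting G → ∀ x → E G' zero (suc x) → IsEdgeCut G' (zero , suc x)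
  new-edge-cut (_ , cut) x ex with u ≟ w
  ... | yes u≡w = pendant-cut u≡w x ex
  new-edge-cut (_ , cut) x (inj₁ refl) | no u≢w =
    inherited-cut (ribbon-sym vw~w'u) (cut v w vw)
    where open Square u≢w
  new-edge-cut (_ , cut) x (inj₂ refl) | no u≢w =
    inherited-cut (ribbon-swapˡ (ribbon-sym uv~ww')) (cut u v uv)
    where open Square u≢w

  retract : Fin (n G') → Fin (n G)
  retract zero = u
  retract (suc x) = x

  to-old : ∀ x → Star (E G') x (suc (retract x))
  to-old zero = inj₁ refl ◅ ε
  to-old (suc x) = ε

  ribbon-cutting : RibbonCutting G → RibbonCutting G'
  ribbon-cutting rc@(conn , cut) = connected-extension conn retract to-old , cut'
    where
    cut' : ∀ a b → E G' a b → IsEdgeCut G' (a , b)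
    cut' (suc a) (suc b) eab = inherited-cut ε (cut a b eab)
    cut' zero (suc x) ex = new-edge-cut rc x ex
    cut' (suc x) zero ex with new-edge-cut rc x ex
    ... | p , q , sep = p , q , separates-resp (flip ◅ ε) sep

-- Base case: the 4-cycle 0-1-2-3-0.  Colouring {0,3} | {1,2} cuts the
-- ribbon {01, 23}; colouring {0,1} | {2,3} cuts the ribbon {12, 30}.

pattern c₀ = zero
pattern c₁ = suc zero
pattern c₂ = suc (suc zero)
pattern c₃ = suc (suc (suc zero))

C4-square : Step C4 (c₀ , c₁) (c₂ , c₃)
C4-square = opp (λ ()) (λ ()) (λ ()) (λ ()) (λ ()) (λ ()) tt tt tt tt

C4-square' : Step C4 (c₁ , c₂) (c₃ , c₀)
C4-square' = opp (λ ()) (λ ()) (λ ()) (λ ()) (λ ()) (λ ()) tt tt tt tt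

side₀₃ : Fin 4 → Bool
side₀₃ c₀ = true
side₀₃ c₁ = false
side₀₃ c₂ = false
side₀₃ c₃ = true

side₀₁ : Fin 4 → Bool
side₀₁ c₀ = true
side₀₁ c₁ = true
side₀₁ c₂ = false
side₀₁ c₃ = false

cross₀₃ : ∀ p q → E C4 p q → side₀₃ p ≢ side₀₃ q → SameRibbon C4 (c₀ , c₁) (p , q)
cross₀₃ c₀ c₁ _ _ = ε
cross₀₃ c₁ c₀ _ _ = flip ◅ ε
cross₀₃ c₂ c₃ _ _ = C4-square ◅ ε
cross₀₃ c₃ c₂ _ _ = C4-square ◅ flip ◅ ε
cross₀₃ c₁ c₂ _ diff = ⊥-elim (diff refl)
cross₀₃ c₂ c₁ _ diff = ⊥-elim (diff refl)
cross₀₃ c₃ c₀ _ diff = ⊥-elim (diff refl)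
cross₀₃ c₀ c₃ _ diff = ⊥-elim (diff refl)

cross₀₁ : ∀ p q → E C4 p q → side₀₁ p ≢ side₀₁ q → SameRibbon C4 (c₁ , c₂) (p , q)
cross₀₁ c₁ c₂ _ _ = ε
cross₀₁ c₂ c₁ _ _ = flip ◅ ε
cross₀₁ c₃ c₀ _ _ = C4-square' ◅ ε
cross₀₁ c₀ c₃ _ _ = C4-square' ◅ flip ◅ ε
cross₀₁ c₀ c₁ _ diff = ⊥-elim (diff refl)
cross₀₁ c₁ c₀ _ diff = ⊥-elim (diff refl)
cross₀₁ c₂ c₃ _ diff = ⊥-elim (diff refl)
cross₀₁ c₃ c₂ _ diff = ⊥-elim (diff refl)

C4-cut : ∀ a b → E C4 a b → IsEdgeCut C4 (a , b)
C4-cut c₀ c₁ e = bichromatic-cut side₀₃ cross₀₃ _ _ e (λ ())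
C4-cut c₁ c₀ e = bichromatic-cut side₀₃ cross₀₃ _ _ e (λ ())
C4-cut c₂ c₃ e = bichromatic-cut side₀₃ cross₀₃ _ _ e (λ ())
C4-cut c₃ c₂ e = bichromatic-cut side₀₃ cross₀₃ _ _ e (λ ())
C4-cut c₁ c₂ e = bichromatic-cut side₀₁ cross₀₁ _ _ e (λ ())
C4-cut c₂ c₁ e = bichromatic-cut side₀₁ cross₀₁ _ _ e (λ ())
C4-cut c₃ c₀ e = bichromatic-cut side₀₁ cross₀₁ _ _ e (λ ())
C4-cut c₀ c₃ e = bichromatic-cut side₀₁ cross₀₁ _ _ e (λ ())

C4-connected : Connected C4
C4-connected x y = to-c₀ x ◅◅ reverse (sym C4) (to-c₀ y)
  where
  to-c₀ : ∀ x → Star (E C4) x c₀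
  to-c₀ c₀ = ε
  to-c₀ c₁ = tt ◅ ε
  to-c₀ c₂ = _◅_ {j = c₁} tt (tt ◅ ε)
  to-c₀ c₃ = tt ◅ ε

proposition3p12 : (G : Graph) → Rec G → RibbonCutting G
proposition3p12 .C4 base = C4-connected , C4-cut
proposition3p12 .(Add4 G u v) (add4 {G} r u v uv) =
  Add4Cutting.ribbon-cutting G u v uv (proposition3p12 G r)
proposition3p12 .(Close4 G u w) (close4 {G} r u v w uv vw _) =
  Close4Cutting.ribbon-cutting G u v w uv vw (proposition3p12 G r)
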